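{- Let $q$ be a power of an odd prime and let $G$ be a connected labeled graph over $\mathbf{F}_q$ on $\{1,\dots,n\}$ with $n\ge3$. Let $\phi_i=(X_i,Y_i,-Y_i,T_i)\in\Lambda_0(G,G)$ for $i=1,2$, with $\phi_1\in\Lambda_0^0(G,G)$, and suppose $\Psi(\phi_1,\phi_2)=aI$ for some nonzero $a\in\mathbf{F}_q$. Then for every vertex $k$, $X_1(k)\ne0$ or $X_2(k)\ne0$.
   Context: A labeled graph is a symmetric matrix $G=(g_{ij})$ over $\mathbf{F}_q$ with zero diagonal; $ij$ is an edge iff $g_{ij}\ne0$. Neighborhood function $g(i)=(g_{i1},\dots,g_{in})$; $e_i$ standard basis vectors; $I$ all-ones vector; $\times$ coordinatewise product; $\langle u,v\rangle=\sum_ku_kv_k$. $\Lambda(G,G)$ is the set of $(X,Y,Z,T)\in(\mathbf{F}_q^n)^4$ with $\langle X,g(i)\times g(j)\rangle-\langle Y,g(i)\times e_j\rangle+\langle Z,e_i\times g(j)\rangle-\langle T,e_i\times e_j\rangle=0$ for all $i,j$. $\Lambda_0(G,G)=\{(X,Y,Z,T)\in\Lambda(G,G):Y+Z=0\}$; $\det(X,Y,Z,T)=Y\times Z-X\times T$; $\Lambda_0^0(G,G)=\{\phi\in\Lambda_0(G,G):\det\phi=0\}$. For $\phi=(X,Y,-Y,T),\phi'=(X',Y',-Y',T')\in\Lambda_0(G,G)$, $\Psi(\phi,\phi')=2Y\times Y'+X\times T'+X'\times T$. -}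

module Defs where

open import Level using (Level; _⊔_)
open import Algebra.Bundles using (CommutativeRing)
open import Data.Nat using (ℕ; zero; suc)
open import Data.Fin using (Fin; _≟_) renaming (zero to fzero; suc to fsuc)
open import Data.Product using (∃; _×_)
open import Relation.Nullary using (¬_; yes; no)
open import Relation.Binary.PropositionalEquality using (_≡_)

module Lab {c ℓ : Level} (R : CommutativeRing c ℓ) where
  open CommutativeRing R

  record IsFiniteFieldOfOrder (q : ℕ) : Set (c ⊔ ℓ) where
    field
      nontrivial      : ¬ (1# ≈ 0#)
      inverses        : ∀ x → ¬ (x ≈ 0#) → ∃ λ y → x * y ≈ 1#
      enum            : Fin q → Carrier
      enum-injective  : ∀ i j → enum i ≈ enum j → i ≡ j
      enum-surjective : ∀ x → ∃ λ i → enum i ≈ x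

  Vect : ℕ → Set c
  Vect n = Fin n → Carrier

  record IsLabeledGraph {n : ℕ} (G : Fin n → Fin n → Carrier) : Set ℓ where
    field
      symmetric : ∀ i j → G i j ≈ G j i
      zeroDiag  : ∀ i → G i i ≈ 0#

  Edge : {n : ℕ} → (Fin n → Fin n → Carrier) → Fin n → Fin n → Set ℓ
  Edge G i j = ¬ (G i j ≈ 0#)

  data Reach {n : ℕ} (G : Fin n → Fin n → Carrier) (i : Fin n) : Fin n → Set (c ⊔ ℓ) where
    here : Reach G i i
    step : ∀ {j k} → Reach G i j → Edge G j k → Reach G i k

  Connected : {n : ℕ} → (Fin n → Fin n → Carrier) → Set (c ⊔ ℓ)
  Connected {n} G = ∀ (i j : Fin n) → Reach G i j

  nbh : {n : ℕ} → (Fin n → Fin n → Carrier) → Fin n → Vect n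
  nbh G i k = G i k

  e : {n : ℕ} → Fin n → Vect n
  e i k with i ≟ k
  ... | yes _ = 1#
  ... | no _  = 0#

  ones : {n : ℕ} → Vect n
  ones _ = 1#

  _⊗_ : {n : ℕ} → Vect n → Vect n → Vect n
  (u ⊗ v) k = u k * v k

  _⊕_ : {n : ℕ} → Vect n → Vect n → Vect n
  (u ⊕ v) k = u k + v k

  _⊖_ : {n : ℕ} → Vect n → Vect n → Vect n
  (u ⊖ v) k = u k - v k

  neg : {n : ℕ} → Vect n → Vect n
  neg u k = - (u k)

  scale : {n : ℕ} → Carrier → Vect n → Vect n
  scale a u k = a * u k

  sumF : (n : ℕ) → Vect n → Carrier
  sumF zero    f = 0#
  sumF (suc n) f = f fzero + sumF n (λ k → f (fsuc k))

  ⟨_,_⟩ : {n : ℕ} → Vect n → Vect n → Carrier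
  ⟨_,_⟩ {n} u v = sumF n (u ⊗ v)

  _≈v_ : {n : ℕ} → Vect n → Vect n → Set ℓ
  u ≈v v = ∀ k → u k ≈ v k

  zeroV : {n : ℕ} → Vect n
  zeroV _ = 0#

  InΛ : {n : ℕ} → (Fin n → Fin n → Carrier) → Vect n → Vect n → Vect n → Vect n → Set ℓ
  InΛ G X Y Z T = ∀ i j →
    ((⟨ X , nbh G i ⊗ nbh G j ⟩ - ⟨ Y , nbh G i ⊗ e j ⟩) + ⟨ Z , e i ⊗ nbh G j ⟩)
      - ⟨ T , e i ⊗ e j ⟩ ≈ 0#

  InΛ₀ : {n : ℕ} → (Fin n → Fin n → Carrier) → Vect n → Vect n → Vect n → Vect n → Set ℓ
  InΛ₀ G X Y Z T = InΛ G X Y Z T × ((Y ⊕ Z) ≈v zeroV)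

  det : {n : ℕ} → Vect n → Vect n → Vect n → Vect n → Vect n
  det X Y Z T = (Y ⊗ Z) ⊖ (X ⊗ T)

  InΛ₀⁰ : {n : ℕ} → (Fin n → Fin n → Carrier) → Vect n → Vect n → Vect n → Vect n → Set ℓ
  InΛ₀⁰ G X Y Z T = InΛ₀ G X Y Z T × (det X Y Z T ≈v zeroV)

  two : Carrier
  two = 1# + 1#

  -- Ψ((X,Y,-Y,T),(X',Y',-Y',T')) = 2 Y×Y' + X×T' + X'×T
  Ψ : {n : ℕ} → Vect n → Vect n → Vect n → Vect n → Vect n → Vect n → Vect n
  Ψ X Y T X' Y' T' = ((scale two (Y ⊗ Y')) ⊕ (X ⊗ T')) ⊕ (X' ⊗ T)

{-# OPTIONS --safe #-}
module Submission where

open import Defs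
open import Level using (Level)
open import Algebra.Bundles using (CommutativeRing)
open import Data.Nat using (ℕ; _^_; _≤_)
open import Data.Nat.Primality using (Prime)
open import Data.Fin using (Fin)
import Data.Fin.Properties as FinProperties
open import Data.Sum using (_⊎_; inj₁; inj₂)
open import Data.Product using (_,_; proj₂)
open import Relation.Nullary using (¬_; yes; no; contradiction)
open import Relation.Binary.Definitions using (Decidable)
open import Relation.Binary.PropositionalEquality using (_≢_; refl)
import Algebra.Properties.Ring as RingProperties
import Relation.Binary.Reasoning.Setoid as SetoidReasoning

-- If X₁(k) = X₂(k) = 0, then det φ₁ = 0 reads Y₁(k)·(−Y₁(k)) = 0, so Y₁(k) = 0 in
-- the field, and then every term of Ψ(φ₁, φ₂)(k) vanishes, contradicting a ≠ 0.

module FiniteField {c ℓ : Level} (R : CommutativeRing c ℓ) {q : ℕ}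
                   (F : Lab.IsFiniteFieldOfOrder R q) where
  open CommutativeRing R
  open RingProperties ring using (-0#≈0#; -‿injective; x∙y⁻¹≈ε⇒x≈y)
  open Lab R
  open IsFiniteFieldOfOrder F
  open SetoidReasoning setoid

  _≟_ : Decidable _≈_
  x ≟ y with enum-surjective x | enum-surjective y
  ... | i , eᵢ≈x | j , eⱼ≈y with i FinProperties.≟ j
  ...   | yes refl = yes (trans (sym eᵢ≈x) eⱼ≈y)
  ...   | no i≢j   = no λ x≈y → i≢j (enum-injective i j (trans eᵢ≈x (trans x≈y (sym eⱼ≈y))))

  x*y≈0⇒x≈0⊎y≈0 : ∀ {x y} → x * y ≈ 0# → x ≈ 0# ⊎ y ≈ 0#
  x*y≈0⇒x≈0⊎y≈0 {x} {y} xy≈0 with x ≟ 0#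
  ... | yes x≈0 = inj₁ x≈0
  ... | no x≉0 with inverses x x≉0
  ...   | x⁻¹ , xx⁻¹≈1 = inj₂ (begin
    y               ≈⟨ sym (*-identityˡ y) ⟩
    1# * y          ≈⟨ *-congʳ (sym xx⁻¹≈1) ⟩
    (x * x⁻¹) * y   ≈⟨ *-congʳ (*-comm x x⁻¹) ⟩
    (x⁻¹ * x) * y   ≈⟨ *-assoc x⁻¹ x y ⟩
    x⁻¹ * (x * y)   ≈⟨ *-congˡ xy≈0 ⟩
    x⁻¹ * 0#        ≈⟨ zeroʳ x⁻¹ ⟩
    0#              ∎)

  x*-x≈0⇒x≈0 : ∀ {x} → x * - x ≈ 0# → x ≈ 0#
  x*-x≈0⇒x≈0 x*-x≈0 with x*y≈0⇒x≈0⊎y≈0 x*-x≈0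
  ... | inj₁ x≈0  = x≈0
  ... | inj₂ -x≈0 = -‿injective (trans -x≈0 (sym -0#≈0#))

  module _ {n : ℕ} (k : Fin n) where

    det≈0∧X≈0⇒Y≈0 : ∀ X Y T → det X Y (neg Y) T k ≈ 0# → X k ≈ 0# → Y k ≈ 0#
    det≈0∧X≈0⇒Y≈0 X Y T det≈0 Xₖ≈0 = x*-x≈0⇒x≈0 (begin
      Y k * - Y k  ≈⟨ x∙y⁻¹≈ε⇒x≈y _ _ det≈0 ⟩
      X k * T k    ≈⟨ *-congʳ Xₖ≈0 ⟩
      0# * T k     ≈⟨ zeroˡ (T k) ⟩
      0#           ∎)

    X≈0∧Y₁≈0⇒Ψ≈0 : ∀ X₁ Y₁ T₁ X₂ Y₂ T₂ → X₁ k ≈ 0# → X₂ k ≈ 0# → Y₁ k ≈ 0# →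
                   Ψ X₁ Y₁ T₁ X₂ Y₂ T₂ k ≈ 0#
    X≈0∧Y₁≈0⇒Ψ≈0 X₁ Y₁ T₁ X₂ Y₂ T₂ X₁ₖ≈0 X₂ₖ≈0 Y₁ₖ≈0 = begin
      two * (Y₁ k * Y₂ k) + X₁ k * T₂ k + X₂ k * T₁ k
        ≈⟨ +-cong (+-cong (*-congˡ (*-congʳ Y₁ₖ≈0)) (*-congʳ X₁ₖ≈0)) (*-congʳ X₂ₖ≈0) ⟩
      two * (0# * Y₂ k) + 0# * T₂ k + 0# * T₁ k
        ≈⟨ +-cong (+-cong (trans (*-congˡ (zeroˡ (Y₂ k))) (zeroʳ two)) (zeroˡ (T₂ k))) (zeroˡ (T₁ k)) ⟩
      0# + 0# + 0#
        ≈⟨ trans (+-identityʳ _) (+-identityʳ 0#) ⟩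
      0#  ∎

    det≈0∧Ψ≈a⇒X₁≉0⊎X₂≉0 : ∀ X₁ Y₁ T₁ X₂ Y₂ T₂ {a} → ¬ (a ≈ 0#) →
                          det X₁ Y₁ (neg Y₁) T₁ k ≈ 0# →
                          Ψ X₁ Y₁ T₁ X₂ Y₂ T₂ k ≈ a * 1# →
                          ¬ (X₁ k ≈ 0#) ⊎ ¬ (X₂ k ≈ 0#)
    det≈0∧Ψ≈a⇒X₁≉0⊎X₂≉0 X₁ Y₁ T₁ X₂ Y₂ T₂ {a} a≉0 det≈0 Ψ≈a
      with X₁ k ≟ 0# | X₂ k ≟ 0#
    ... | no X₁ₖ≉0  | _          = inj₁ X₁ₖ≉0
    ... | yes _     | no X₂ₖ≉0   = inj₂ X₂ₖ≉0
    ... | yes X₁ₖ≈0 | yes X₂ₖ≈0 = contradiction a≈0 a≉0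
      where
      Y₁ₖ≈0 : Y₁ k ≈ 0#
      Y₁ₖ≈0 = det≈0∧X≈0⇒Y≈0 X₁ Y₁ T₁ det≈0 X₁ₖ≈0

      a≈0 : a ≈ 0#
      a≈0 = begin
        a                        ≈⟨ sym (*-identityʳ a) ⟩
        a * 1#                   ≈⟨ sym Ψ≈a ⟩
        Ψ X₁ Y₁ T₁ X₂ Y₂ T₂ k    ≈⟨ X≈0∧Y₁≈0⇒Ψ≈0 X₁ Y₁ T₁ X₂ Y₂ T₂ X₁ₖ≈0 X₂ₖ≈0 Y₁ₖ≈0 ⟩
        0#                       ∎

mainTheorem10 : {c ℓ : Level} (R : CommutativeRing c ℓ) →
    let open CommutativeRing R in
    (p e : ℕ) → Prime p → p ≢ 2 → 1 ≤ e →
    Lab.IsFiniteFieldOfOrder R (p ^ e) →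
    (n : ℕ) → 3 ≤ n →
    (G : Fin n → Fin n → Carrier) →
    Lab.IsLabeledGraph R G → Lab.Connected R G →
    (X₁ Y₁ T₁ X₂ Y₂ T₂ : Fin n → Carrier) →
    Lab.InΛ₀ R G X₁ Y₁ (Lab.neg R Y₁) T₁ →
    Lab.InΛ₀ R G X₂ Y₂ (Lab.neg R Y₂) T₂ →
    Lab.InΛ₀⁰ R G X₁ Y₁ (Lab.neg R Y₁) T₁ →
    (a : Carrier) → ¬ (a ≈ 0#) →
    Lab._≈v_ R (Lab.Ψ R X₁ Y₁ T₁ X₂ Y₂ T₂) (Lab.scale R a (Lab.ones R)) →
    (k : Fin n) → ¬ (X₁ k ≈ 0#) ⊎ ¬ (X₂ k ≈ 0#)
mainTheorem10 R _ _ _ _ _ F _ _ _ _ _ X₁ Y₁ T₁ X₂ Y₂ T₂ _ _ φ₁∈Λ₀⁰ _ a≉0 Ψ≈aI k =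
  FiniteField.det≈0∧Ψ≈a⇒X₁≉0⊎X₂≉0 R F k X₁ Y₁ T₁ X₂ Y₂ T₂ a≉0 (proj₂ φ₁∈Λ₀⁰ k) (Ψ≈aI k)
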